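{- Let $\mathrm{Exc}$ be a nonempty set, and let $\Sigma$ consist of, for each $e\in\mathrm{Exc}$, a nullary operator $\mathsf{raise}_e$ and a binary operator $\mathsf{catch}_e$. Let $\mathcal{E}\subseteq(T\mathbb{N})^2$ be a complete, single-valued algebraic relation containing (in both directions) the equations, for all $e,d\in\mathrm{Exc}$ and distinct variables $x,y,z$: $\mathsf{catch}_e(\mathsf{raise}_e,x)=x$; $\mathsf{catch}_e(\mathsf{raise}_d,x)=\mathsf{raise}_d$ if $e\neq d$; $\mathsf{catch}_e(x,x)=x$; $\mathsf{catch}_e(\mathsf{catch}_e(x,y),z)=\mathsf{catch}_e(x,\mathsf{catch}_e(y,z))$; $\mathsf{catch}_e(\bot,x)=\bot$; $\mathsf{catch}_e(\top,x)=\top$. Then $\mathcal{E}=(T\mathbb{N})^2$.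
   Context: For a set $X$, $TX$ is the set of possibly infinite-depth trees with leaves $\bot$, $\top$, $\langle x\rangle$ ($x\in X$), or $\mathsf{raise}_e$, and binary internal nodes labelled $\mathsf{catch}_e$. $T$ is a monad with $\eta(x)=\langle x\rangle$, $Tf$ relabelling leaves $\langle x\rangle$, $\mu$ substituting trees at leaves, and $f^*:=\mu\circ Tf$. Variables are leaves $\langle n\rangle$, $n\in\mathbb{N}$. Tree order $\le_{T\mathbb{N}}$ ($\mathbb{N}$ discrete): the largest relation $R$ such that $s\,R\,t$ implies $s=\bot$, or $t=\top$, or $s=t=\langle n\rangle$, or $s$ and $t$ have the same operator at the root with children pairwise related by $R$; $T\mathbb{N}$ is $\omega$-complete with suprema $\bigvee$. An algebraic relation $\mathcal{E}\subseteq(T\mathbb{N})^2$ (write $a\,\mathcal{E}\,b$) is complete if it is reflexive, transitive, substitutional ($a\,\mathcal{E}\,b\Rightarrow f^*(a)\,\mathcal{E}\,f^*(b)$ for $f:\mathbb{N}\to T\mathbb{N}$), compositional ($a\,\mathcal{E}\,b$ and $f(n)\,\mathcal{E}\,g(n)$ for all $n$ imply $f^*(a)\,\mathcal{E}\,g^*(b)$), ordered ($a\le_{T\mathbb{N}}b\Rightarrow a\,\mathcal{E}\,b$) and admissible (for ascending $(a_n),(b_n)$ with $a_n\,\mathcal{E}\,b_n$, $\bigvee a_n\,\mathcal{E}\,\bigvee b_n$). It is single-valued if, for all $a,b$: $f^*(a)\,\mathcal{E}\,f^*(b)$ for all $f:\mathbb{N}\to\{\bot,\langle 0\rangle\}$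 implies $a\,\mathcal{E}\,b$. An equation $a=b$ is contained in $\mathcal{E}$ when both $(a,b)$ and $(b,a)$ are. -}

module Defs where

open import Data.Nat using (ℕ; zero; suc)
open import Data.Bool using (Bool; true; false; if_then_else_)
open import Data.List using (List; []; _∷_)
open import Data.Product using (_×_; Σ; ∃)
open import Data.Sum using (_⊎_)
open import Relation.Binary.PropositionalEquality using (_≡_)
open import Relation.Nullary using (¬_)

-- Possibly infinite-depth trees: a tree is given by the operator labelling each
-- position, positions being paths (false = left child, true = right).
-- Only positions reachable through catch-nodes matter; labels at other
-- positions are junk.

data Label (Exc X : Set) : Set where
  bot   : Label Exc X
  top   : Label Exc X
  leaf  : X → Label Exc X
  raise : Exc → Label Exc X
  catch : Exc → Label Exc X

Tree : Set → Set → Set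
Tree Exc X = List Bool → Label Exc X

module _ {Exc : Set} where

  child : ∀ {X} → Bool → Tree Exc X → Tree Exc X
  child b t p = t (b ∷ p)

  botT topT : ∀ {X} → Tree Exc X
  botT _ = bot
  topT _ = top

  η : ∀ {X} → X → Tree Exc X
  η x _ = leaf x

  raiseT : ∀ {X} → Exc → Tree Exc X
  raiseT e _ = raise e

  catchT : ∀ {X} → Exc → Tree Exc X → Tree Exc X → Tree Exc X
  catchT e l r []          = catch e
  catchT e l r (false ∷ p) = l p
  catchT e l r (true ∷ p)  = r p

  -- Kleisli extension f* = μ ∘ T f : substitute f x at every leaf ⟨x⟩
  bind : ∀ {X Y} → (X → Tree Exc Y) → Tree Exc X → Tree Exc Y
  bind f t [] with t []
  ... | bot     = bot
  ... | top     = top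
  ... | leaf x  = f x []
  ... | raise e = raise e
  ... | catch e = catch e
  bind f t (b ∷ p) with t []
  ... | leaf x  = f x (b ∷ p)
  ... | catch e = bind f (child b t) p
  ... | bot     = bot      -- junk (unreachable position)
  ... | top     = bot
  ... | raise _ = bot

  -- The tree order on T ℕ (ℕ discrete): the largest relation R with
  -- s R t ⇒ s = ⊥, or t = ⊤, or s = t = ⟨n⟩, or same root operator and
  -- children pairwise related by R.

  Rel₀ : Set₁
  Rel₀ = Tree Exc ℕ → Tree Exc ℕ → Set

  data Step (R : Rel₀) (s t : Tree Exc ℕ) : Set where
    st-bot   : s [] ≡ bot → Step R s t
    st-top   : t [] ≡ top → Step R s t
    st-leaf  : ∀ n → s [] ≡ leaf n → t [] ≡ leaf n → Step R s t
    st-raise : ∀ e → s [] ≡ raise e → t [] ≡ raise e → Step R s t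
    st-catch : ∀ e → s [] ≡ catch e → t [] ≡ catch e →
               R (child false s) (child false t) →
               R (child true s) (child true t) → Step R s t

  IsTreeSim : Rel₀ → Set
  IsTreeSim R = ∀ s t → R s t → Step R s t

  -- largest such relation = union of all post-fixed points
  _≤T_ : Tree Exc ℕ → Tree Exc ℕ → Set₁
  s ≤T t = Σ Rel₀ λ R → IsTreeSim R × R s t

  Ascending : (ℕ → Tree Exc ℕ) → Set₁
  Ascending a = ∀ n → a n ≤T a (suc n)

  IsSup : (ℕ → Tree Exc ℕ) → Tree Exc ℕ → Set₁
  IsSup a s = (∀ n → a n ≤T s) × (∀ u → (∀ n → a n ≤T u) → s ≤T u)

  Reflexive : Rel₀ → Set
  Reflexive E = ∀ a → E a a

  Transitive : Rel₀ → Set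
  Transitive E = ∀ a b c → E a b → E b c → E a c

  Substitutional : Rel₀ → Set
  Substitutional E = ∀ (f : ℕ → Tree Exc ℕ) a b → E a b → E (bind f a) (bind f b)

  Compositional : Rel₀ → Set
  Compositional E = ∀ (f g : ℕ → Tree Exc ℕ) a b →
    E a b → (∀ n → E (f n) (g n)) → E (bind f a) (bind g b)

  Ordered : Rel₀ → Set₁
  Ordered E = ∀ a b → a ≤T b → E a b

  Admissible : Rel₀ → Set₁
  Admissible E = ∀ (a b : ℕ → Tree Exc ℕ) (sa sb : Tree Exc ℕ) →
    Ascending a → Ascending b → (∀ n → E (a n) (b n)) →
    IsSup a sa → IsSup b sb → E sa sb

  record Complete (E : Rel₀) : Set₁ where
    field
      reflexive      : Reflexive E
      transitive     : Transitive E
      substitutional : Substitutional E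
      compositional  : Compositional E
      ordered        : Ordered E
      admissible     : Admissible E

  -- maps f : ℕ → {⊥, ⟨0⟩}, encoded by a Bool-valued choice
  botOrZero : (ℕ → Bool) → ℕ → Tree Exc ℕ
  botOrZero g n = if g n then η 0 else botT

  SingleValued : Rel₀ → Set
  SingleValued E = ∀ a b →
    (∀ (g : ℕ → Bool) → E (bind (botOrZero g) a) (bind (botOrZero g) b)) → E a b

  Contains : Rel₀ → Tree Exc ℕ → Tree Exc ℕ → Set
  Contains E a b = E a b × E b a

  vx vy vz : Tree Exc ℕ
  vx = η 0
  vy = η 1
  vz = η 2

  record ExceptionAxioms (E : Rel₀) : Set where
    field
      catch-raise-same : ∀ e → Contains E (catchT e (raiseT e) vx) vx
      catch-raise-diff : ∀ e d → ¬ (e ≡ d) → Contains E (catchT e (raiseT d) vx) (raiseT d)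
      catch-idem       : ∀ e → Contains E (catchT e vx vx) vx
      catch-assoc      : ∀ e → Contains E (catchT e (catchT e vx vy) vz) (catchT e vx (catchT e vy vz))
      catch-bot        : ∀ e → Contains E (catchT e botT vx) botT
      catch-top        : ∀ e → Contains E (catchT e topT vx) topT

module Submission where

--  * Single-valuedness reduces  catch(x, y) E x  to its instances with
--    x, y ∈ {⊥, ⟨0⟩}: for x = ⊥ it is  catch(⊥, y) = ⊥,  for x = ⟨0⟩ it
--    follows from  y ≤ ⟨0⟩,  compositionality and  catch(x, x) = x.
--  * Hence every t satisfies  t = catch(raise_e, t) E raise_e.
--  * Finally  a E ⊤ = catch(⊤, ⊥) E catch(raise_e, ⊥) = ⊥ E b.

open import Defs
open import Data.Nat using (ℕ; zero; suc)
open import Data.Bool using (true; false)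
open import Data.List using ([]; _∷_)
open import Data.Product using (_×_; _,_; proj₁; proj₂)
open import Data.Sum using (_⊎_; inj₁; inj₂)
open import Function using (const)
open import Relation.Binary.Bundles using (Preorder)
open import Relation.Binary.PropositionalEquality
  using (_≡_; _≗_; refl; sym; trans)
import Relation.Binary.Reasoning.Preorder as PreorderReasoning

module Substitution {Exc : Set} where

  -- Substitution commutes with catch and acts on variables by lookup.
  -- (On the constants ⊤ and raise it agrees with the identity only at
  -- reachable positions, so those cases are handled through E below.)

  bind-η : ∀ (f : ℕ → Tree Exc ℕ) n → bind f (η n) ≗ f n
  bind-η f n []      = refl
  bind-η f n (_ ∷ _) = refl

  bind-botT : ∀ (f : ℕ → Tree Exc ℕ) → bind f botT ≗ botT
  bind-botT f []      = refl
  bind-botT f (_ ∷ _) = refl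

  bind-catch : ∀ (f : ℕ → Tree Exc ℕ) d l r →
               bind f (catchT d l r) ≗ catchT d (bind f l) (bind f r)
  bind-catch f d l r []          = refl
  bind-catch f d l r (false ∷ _) = refl
  bind-catch f d l r (true ∷ _)  = refl

  catch-cong-≗ : ∀ {d} {l l' r r' : Tree Exc ℕ} →
                 l ≗ l' → r ≗ r' → catchT d l r ≗ catchT d l' r'
  catch-cong-≗ l≗l' r≗r' []          = refl
  catch-cong-≗ l≗l' r≗r' (false ∷ p) = l≗l' p
  catch-cong-≗ l≗l' r≗r' (true ∷ p)  = r≗r' p

  bind-catch-xy : ∀ (f : ℕ → Tree Exc ℕ) d → bind f (catchT d vx vy) ≗ catchT d (f 0) (f 1)
  bind-catch-xy f d p =
    trans (bind-catch f d vx vy p) (catch-cong-≗ (bind-η f 0) (bind-η f 1) p)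

  pair : Tree Exc ℕ → Tree Exc ℕ → ℕ → Tree Exc ℕ
  pair l r zero    = l
  pair l r (suc _) = r

module CompleteRelation {Exc : Set} (E : Rel₀ {Exc}) (C : Complete E) where
  open Complete C
  open Substitution

  ≗-step : IsTreeSim {Exc} _≗_
  ≗-step s t s≗t with s [] in s₀
  ... | bot     = st-bot s₀
  ... | top     = st-top (trans (sym (s≗t [])) s₀)
  ... | leaf n  = st-leaf n s₀ (trans (sym (s≗t [])) s₀)
  ... | raise d = st-raise d s₀ (trans (sym (s≗t [])) s₀)
  ... | catch d = st-catch d s₀ (trans (sym (s≗t [])) s₀)
                    (λ p → s≗t (false ∷ p)) (λ p → s≗t (true ∷ p))

  ≗⇒E : ∀ {s t} → s ≗ t → E s t
  ≗⇒E {s} {t} s≗t = ordered s t (_≗_ , ≗-step , s≗t)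

  E-bot : ∀ {s} t → s [] ≡ bot → E s t
  E-bot {s} t s₀ = ordered s t ((λ u _ → u [] ≡ bot) , (λ _ _ → st-bot) , s₀)

  E-top : ∀ s {t} → t [] ≡ top → E s t
  E-top s {t} t₀ = ordered s t ((λ _ u → u [] ≡ top) , (λ _ _ → st-top) , t₀)

  E-raise : ∀ {s t d} → s [] ≡ raise d → t [] ≡ raise d → E s t
  E-raise {s} {t} {d} s₀ t₀ =
    ordered s t ((λ u v → u [] ≡ raise d × v [] ≡ raise d) ,
                 (λ _ _ (u₀ , v₀) → st-raise d u₀ v₀) , (s₀ , t₀))

  preorder : Preorder _ _ _
  preorder = record
    { Carrier    = Tree Exc ℕ
    ; _≈_        = _≗_
    ; _≲_        = E
    ; isPreorder = record
      { isEquivalence = record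
        { refl  = λ _ → refl
        ; sym   = λ s≗t p → sym (s≗t p)
        ; trans = λ s≗t t≗u p → trans (s≗t p) (t≗u p)
        }
      ; reflexive = ≗⇒E
      ; trans     = λ {a} {b} {c} → transitive a b c
      }
    }

  open PreorderReasoning preorder public

  -- catch_d is monotone in both arguments (compositionality at catch_d(x, y)).
  catch-cong : ∀ {d l l' r r'} → E l l' → E r r' → E (catchT d l r) (catchT d l' r')
  catch-cong {d} {l} {l'} {r} {r'} l≲l' r≲r' = begin
    catchT d l r                     ≈⟨ bind-catch-xy (pair l r) d ⟨
    bind (pair l r) (catchT d vx vy)   ≲⟨ compositional (pair l r) (pair l' r') _ _
                                           (reflexive _) pointwise ⟩
    bind (pair l' r') (catchT d vx vy) ≈⟨ bind-catch-xy (pair l' r') d ⟩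
    catchT d l' r'                   ∎
    where
      pointwise : ∀ n → E (pair l r n) (pair l' r' n)
      pointwise zero    = l≲l'
      pointwise (suc _) = r≲r'

module Collapse {Exc : Set} (e : Exc) (E : Rel₀ {Exc}) (C : Complete E)
                (SV : SingleValued E) (AX : ExceptionAxioms E) where
  open Complete C
  open ExceptionAxioms AX
  open Substitution
  open CompleteRelation E C

  BotOrZero : Tree Exc ℕ → Set
  BotOrZero u = u ≗ botT ⊎ u ≗ η 0

  botOrZero-values : ∀ g n → BotOrZero (botOrZero g n)
  botOrZero-values g n with g n
  ... | true  = inj₂ (λ _ → refl)
  ... | false = inj₁ (λ _ → refl)

  below-zero : ∀ {v} → BotOrZero v → E v (η 0)
  below-zero (inj₁ v≗⊥) = E-bot _ (v≗⊥ [])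
  below-zero (inj₂ v≗0) = ≗⇒E v≗0

  catch-first-on-values : ∀ {u v} → BotOrZero u → BotOrZero v → E (catchT e u v) u
  catch-first-on-values {u} {v} (inj₁ u≗⊥) _ = begin
    catchT e u v                     ≈⟨ catch-cong-≗ u≗⊥ (λ _ → refl) ⟩
    catchT e botT v                  ≈⟨ catch-cong-≗ (bind-botT (const v)) (bind-η (const v) 0) ⟨
    catchT e (bind (const v) botT) (bind (const v) vx)
                                     ≈⟨ bind-catch (const v) e botT vx ⟨
    bind (const v) (catchT e botT vx) ≲⟨ substitutional (const v) _ _ (proj₁ (catch-bot e)) ⟩
    bind (const v) botT               ≲⟨ E-bot u refl ⟩
    u                                ∎
  catch-first-on-values {u} {v} (inj₂ u≗0) v∈ = begin
    catchT e u v                     ≈⟨ catch-cong-≗ u≗0 (λ _ → refl) ⟩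
    catchT e (η 0) v                 ≲⟨ catch-cong (reflexive (η 0)) (below-zero v∈) ⟩
    catchT e vx vx                   ≲⟨ proj₁ (catch-idem e) ⟩
    η 0                              ≈⟨ u≗0 ⟨
    u                                ∎

  catch-projection : E (catchT e vx vy) vx
  catch-projection = SV _ _ λ g → let h = botOrZero g in begin
    bind h (catchT e vx vy)  ≈⟨ bind-catch-xy h e ⟩
    catchT e (h 0) (h 1)     ≲⟨ catch-first-on-values (botOrZero-values g 0)
                                                      (botOrZero-values g 1) ⟩
    h 0                      ≈⟨ bind-η h 0 ⟨
    bind h vx                ∎

  catch-first : ∀ l r → E (catchT e l r) l
  catch-first l r = begin
    catchT e l r                     ≈⟨ bind-catch-xy (pair l r) e ⟨
    bind (pair l r) (catchT e vx vy) ≲⟨ substitutional (pair l r) _ _ catch-projection ⟩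
    bind (pair l r) vx               ≈⟨ bind-η (pair l r) 0 ⟩
    l                                ∎

  -- Every tree is below raise_e:  t = catch(raise_e, t) E raise_e.
  below-raise : ∀ t → E t (raiseT e)
  below-raise t = begin
    t                                       ≈⟨ bind-η (const t) 0 ⟨
    bind (const t) vx                       ≲⟨ substitutional (const t) _ _
                                                 (proj₂ (catch-raise-same e)) ⟩
    bind (const t) (catchT e (raiseT e) vx) ≈⟨ bind-catch (const t) e (raiseT e) vx ⟩
    catchT e (bind (const t) (raiseT e)) (bind (const t) vx)
                                            ≲⟨ catch-first _ _ ⟩
    bind (const t) (raiseT e)               ≲⟨ E-raise refl refl ⟩
    raiseT e                                ∎

  collapse : ∀ a b → E a b
  collapse a b = begin
    a                                  ≲⟨ E-top a refl ⟩
    ⊥[ topT ]                          ≲⟨ substitutional (const botT) _ _ (proj₂ (catch-top e)) ⟩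
    ⊥[ catchT e topT vx ]              ≈⟨ bind-catch (const botT) e topT vx ⟩
    catchT e ⊥[ topT ] ⊥[ vx ]         ≲⟨ catch-cong (below-raise _) (reflexive _) ⟩
    catchT e (raiseT e) ⊥[ vx ]        ≲⟨ catch-cong (E-raise refl refl) (reflexive _) ⟩
    catchT e ⊥[ raiseT e ] ⊥[ vx ]     ≈⟨ bind-catch (const botT) e (raiseT e) vx ⟨
    ⊥[ catchT e (raiseT e) vx ]        ≲⟨ substitutional (const botT) _ _ (proj₁ (catch-raise-same e)) ⟩
    ⊥[ vx ]                            ≲⟨ E-bot b refl ⟩
    b                                  ∎
    where
      ⊥[_] : Tree Exc ℕ → Tree Exc ℕ
      ⊥[ t ] = bind (const botT) t

mainTheorem12 : (Exc : Set) → Exc → (E : Rel₀ {Exc}) → Complete E → SingleValued E → ExceptionAxioms E → ∀ a b → E a b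
mainTheorem12 Exc e E C SV AX = Collapse.collapse e E C SV AX
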